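{- Let $G$ be a finite group, $T_0,T_1\subseteq G$, and let $X=BD(G,T_0,T_1)$ be a strongly connected Bi-Cayley digraph with $\kappa(X)<\delta(X)$. Let $A$ be an atom of $X$, write $A_i=A\cap X_i=H_i\times\{i\}$ with $H_i\subseteq G$ for $i=0,1$, and let $Y=X[A]$. Then (1) if $A$ is a positive (respectively, negative) atom, then $V(X)$ is a disjoint union of distinct positive (respectively, negative) atoms of $X$; (2) $\mathrm{Aut}(Y)$ acts transitively on $A_0$ and on $A_1$; (3) for $i\in\{0,1\}$, if $(1_G,i)\in A_i$, then $H_i$ is a subgroup of $G$; (4) $|A_0|=|A_1|$.
   Context: The Bi-Cayley digraph $BD(G,T_0,T_1)$ is the bipartite digraph with vertex set $G\times\{0,1\}$ and arc set $\{((g,0),(t_0g,1)) : g\in G,\ t_0\in T_0\}\cup\{((t_1g,1),(g,0)) : g\in G,\ t_1\in T_1\}$; $X_0=G\times\{0\}$, $X_1=G\times\{1\}$. $\delta(X)$ is the minimum of the minimum out-degree and minimum in-degree. $\kappa(X)$ is the minimum cardinality of a vertex set whose deletion leaves a trivial (one-vertex) or not strongly connected digraph. For $F\subseteq V$, $N^+(F)$ (resp. $N^-(F)$) is the set of vertices of $V\setminus F$ that are heads (resp. tails) of arcs whose tail (resp. head) lies in $F$; $C^\pm(F)=F\cup N^\pm(F)$. A nonempty $F\subseteq V$ is a positive (resp. negative) fragment if $|N^+(F)|=\kappa(X)$ and $C^+(F)\ne V$ (resp. $|N^-(F)|=\kappa(X)$ and $C^-(F)\neq V$). An atom is a fragment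 (positive or negative) of minimum cardinality among all fragments; it is a positive (resp. negative) atom if it is a positive (resp. negative) fragment. $X[A]$ denotes the subdigraph induced by $A$. -}

module Defs where

open import Data.Nat using (ℕ; zero; suc; _+_; _≤_; _<_)
open import Data.Fin using (Fin; zero; suc)
open import Data.Bool using (Bool; true; false; _∨_; _∧_; not; if_then_else_)
open import Data.Product using (Σ; _×_; _,_; proj₁; proj₂; ∃)
open import Data.Sum using (_⊎_)
open import Relation.Nullary using (¬_)
open import Relation.Binary.PropositionalEquality using (_≡_)
open import Function.Bundles using (_↔_; Inverse)

record FinGroup (n : ℕ) : Set where
  field
    _·_   : Fin n → Fin n → Fin n
    e     : Fin n
    inv   : Fin n → Fin n
    assoc : ∀ x y z → (x · y) · z ≡ x · (y · z)
    idˡ   : ∀ x → e · x ≡ x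
    idʳ   : ∀ x → x · e ≡ x
    invˡ  : ∀ x → inv x · x ≡ e
    invʳ  : ∀ x → x · inv x ≡ e

SubsetG : ℕ → Set
SubsetG n = Fin n → Bool

IsSubgroup : ∀ {n} → FinGroup n → SubsetG n → Set
IsSubgroup G H =
  (H e ≡ true) ×
  (∀ x y → H x ≡ true → H y ≡ true → H (x · y) ≡ true) ×
  (∀ x → H x ≡ true → H (inv x) ≡ true)
  where open FinGroup G

anyFin : ∀ {n} → (Fin n → Bool) → Bool
anyFin {zero}  f = false
anyFin {suc n} f = f zero ∨ anyFin (λ i → f (suc i))

countFin : ∀ {n} → (Fin n → Bool) → ℕ
countFin {zero}  f = 0
countFin {suc n} f = (if f zero then 1 else 0) + countFin (λ i → f (suc i))

-- Digraphs on the vertex set G × {0,1}  (false = 0, true = 1).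

V : ℕ → Set
V n = Fin n × Bool

VSet : ℕ → Set
VSet n = V n → Bool

Digraph : ℕ → Set
Digraph n = V n → V n → Bool

anyV : ∀ {n} → VSet n → Bool
anyV f = anyFin (λ g → f (g , false)) ∨ anyFin (λ g → f (g , true))

∣_∣V : ∀ {n} → VSet n → ℕ
∣ f ∣V = countFin (λ g → f (g , false)) + countFin (λ g → f (g , true))

-- the part  F ∩ X_i  seen as a subset of G  (this is H_i when F = A)
part : ∀ {n} → VSet n → Bool → SubsetG n
part F i g = F (g , i)

_∈V_ : ∀ {n} → V n → VSet n → Set
v ∈V F = F v ≡ true

-- Bi-Cayley digraph BD(G,T0,T1):
--   arcs (g,0) → (t0 g,1) for t0 ∈ T0, and (t1 g,1) → (g,0) for t1 ∈ T1,
-- i.e. (g,0)→(h,1) iff h g⁻¹ ∈ T0 and (h,1)→(g,0) iff h g⁻¹ ∈ T1.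
BD : ∀ {n} → FinGroup n → SubsetG n → SubsetG n → Digraph n
BD G T0 T1 (g , false) (h , true)  = T0 (h · inv g) where open FinGroup G
BD G T0 T1 (h , true)  (g , false) = T1 (h · inv g) where open FinGroup G
BD G T0 T1 (_ , false) (_ , false) = false
BD G T0 T1 (_ , true)  (_ , true)  = false

module _ {n : ℕ} (D : Digraph n) where

  outdeg : V n → ℕ
  outdeg u = ∣ (λ v → D u v) ∣V

  indeg : V n → ℕ
  indeg v = ∣ (λ u → D u v) ∣V

  IsMinDegree : ℕ → Set
  IsMinDegree d = (∀ v → (d ≤ outdeg v) × (d ≤ indeg v))
                × ∃ λ v → (outdeg v ≡ d) ⊎ (indeg v ≡ d)

  data Reach (S : VSet n) : V n → V n → Set where
    here : ∀ {u} → u ∈V S → Reach S u u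
    step : ∀ {u v w} → u ∈V S → D u v ≡ true → Reach S v w → Reach S u w

  StronglyConnectedOn : VSet n → Set
  StronglyConnectedOn S = ∀ u v → u ∈V S → v ∈V S → Reach S u v

  StronglyConnected : Set
  StronglyConnected = StronglyConnectedOn (λ _ → true)

  IsCut : VSet n → Set
  IsCut S = (∣ (λ v → not (S v)) ∣V ≤ 1) ⊎ ¬ StronglyConnectedOn (λ v → not (S v))

  IsConnectivity : ℕ → Set
  IsConnectivity k = (∃ λ S → IsCut S × (∣ S ∣V ≡ k)) × (∀ S → IsCut S → k ≤ ∣ S ∣V)

  N⁺ : VSet n → VSet n
  N⁺ F v = not (F v) ∧ anyV (λ u → F u ∧ D u v)

  N⁻ : VSet n → VSet n
  N⁻ F v = not (F v) ∧ anyV (λ u → F u ∧ D v u)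

  C⁺ : VSet n → VSet n
  C⁺ F v = F v ∨ N⁺ F v

  C⁻ : VSet n → VSet n
  C⁻ F v = F v ∨ N⁻ F v

  Nonempty : VSet n → Set
  Nonempty F = ∃ λ v → v ∈V F

  NotAll : VSet n → Set
  NotAll F = ∃ λ v → F v ≡ false

  module _ (κ : ℕ) where

    PosFragment : VSet n → Set
    PosFragment F = Nonempty F × (∣ N⁺ F ∣V ≡ κ) × NotAll (C⁺ F)

    NegFragment : VSet n → Set
    NegFragment F = Nonempty F × (∣ N⁻ F ∣V ≡ κ) × NotAll (C⁻ F)

    Fragment : VSet n → Set
    Fragment F = PosFragment F ⊎ NegFragment F

    Atom : VSet n → Set
    Atom A = Fragment A × (∀ F → Fragment F → ∣ A ∣V ≤ ∣ F ∣V)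

    PosAtom : VSet n → Set
    PosAtom A = Atom A × PosFragment A

    NegAtom : VSet n → Set
    NegAtom A = Atom A × NegFragment A

    DisjointUnionOf : (VSet n → Set) → Set
    DisjointUnionOf Q =
      Σ ℕ λ m → Σ (Fin m → VSet n) λ P →
        (∀ j → Q (P j)) ×
        (∀ v → Σ (Fin m) λ j → (v ∈V P j) × (∀ j' → v ∈V P j' → j' ≡ j))

  Elt : VSet n → Set
  Elt A = Σ (V n) λ v → v ∈V A

  record Aut (A : VSet n) : Set where
    field
      perm     : Elt A ↔ Elt A
      preserve : ∀ u v → D (proj₁ u) (proj₁ v)
                       ≡ D (proj₁ (Inverse.to perm u)) (proj₁ (Inverse.to perm v))

  TransitiveOnPart : VSet n → Bool → Set
  TransitiveOnPart A i =
    ∀ (u v : Elt A) → proj₂ (proj₁ u) ≡ i → proj₂ (proj₁ v) ≡ i →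
      Σ (Aut A) λ σ → Inverse.to (Aut.perm σ) u ≡ v

module Submission where

-- A positive atom A meets every positive fragment B that it intersects in all of A: if some
-- vertex lies outside C⁺A ∪ C⁺B, submodularity of |N⁺| makes A ∩ B a positive fragment, so
-- A ⊆ B by minimality; otherwise the complement of C⁺B is a negative fragment smaller than A.
-- Right translations (g , i) ↦ (g h , i) are automorphisms of a Bi-Cayley digraph, so the
-- translates of A are positive atoms, and any two of them are equal or disjoint. This yields
-- the partition (1), the automorphisms w ↦ w a⁻¹b of X[A] (2), and the closure property
-- (a , i), (b , j), (y , j) ∈ A ⇒ (a b⁻¹ y , i) ∈ A, from which (3) and (4) follow once κ < δ
-- forces A to meet both sides. A negative atom is a positive atom of the converse digraph.

open import Defs
open import Algebra.Bundles using (Group)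
import Algebra.Properties.Group
open import Axiom.UniquenessOfIdentityProofs using (module Decidable⇒UIP)
open import Data.Bool using (Bool; true; false; _∨_; _∧_; not; if_then_else_)
import Data.Bool.Properties as Bool
open import Data.Empty using (⊥; ⊥-elim)
open import Data.Fin using (Fin; zero; suc)
open import Data.Fin.Permutation using (Permutation; permutation; _⟨$⟩ʳ_)
open import Data.Fin.Properties using (all?)
open import Data.List using (List; length; lookup; allFin; deduplicate)
open import Data.List.Membership.Propositional using (lose)
open import Data.List.Membership.Propositional.Properties using (∈-lookup; ∈-allFin)
import Data.List.Relation.Unary.All as All
open import Data.List.Relation.Unary.AllPairs using (_∷_)
open import Data.List.Relation.Unary.Any as Any using (Any)
open import Data.List.Relation.Unary.Any.Properties as Any using (lookup-index)
open import Data.List.Relation.Unary.Unique.DecSetoid.Properties using (deduplicate-!)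
open import Data.List.Relation.Unary.Unique.Setoid using (Unique)
open import Data.Nat using (ℕ; zero; suc; _+_; _≤_; _<_; z≤n; s≤s)
open import Data.Nat.Properties
open import Algebra.Properties.CommutativeMonoid.Sum +-0-commutativeMonoid using (sum; sum-permute)
open import Algebra.Properties.CommutativeSemigroup +-commutativeSemigroup using (interchange)
open import Data.Product using (Σ; _×_; _,_; proj₁; proj₂; ∃)
open import Data.Sum as Sum using (_⊎_; inj₁; inj₂; swap; [_,_])
open import Data.Vec.Functional using (tail)
open import Function using (id)
open import Function.Bundles using (mk↔ₛ′)
open import Level using (0ℓ)
open import Relation.Binary.Bundles using (Setoid; DecSetoid)
open import Relation.Binary.PropositionalEquality
  using (_≡_; refl; sym; trans; cong; cong₂; subst; isEquivalence; ≢-sym; module ≡-Reasoning)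
open import Relation.Nullary using (¬_; Dec; yes; no)
open import Relation.Nullary.Decidable using (map′; _×-dec_)

private
  variable
    n : ℕ
    F G H K S : VSet n
    D : Digraph n

infix  4 _⊆_ _∉V_
infixr 7 _∩_ _∖_
infixr 6 _∪_

_∉V_ : V n → VSet n → Set
v ∉V F = F v ≡ false

_⊆_ : VSet n → VSet n → Set
F ⊆ G = ∀ v → v ∈V F → v ∈V G

_∩_ _∪_ _∖_ : VSet n → VSet n → VSet n
(F ∩ G) v = F v ∧ G v
(F ∪ G) v = F v ∨ G v
(F ∖ G) v = F v ∧ not (G v)

∁ : VSet n → VSet n
∁ F v = not (F v)

true≢false : ∀ {x} → x ≡ true → x ≡ false → ⊥
true≢false refl ()

∧-intro : ∀ {x y} → x ≡ true → y ≡ true → x ∧ y ≡ true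
∧-intro refl refl = refl

∧-elim : ∀ {x y} → x ∧ y ≡ true → x ≡ true × y ≡ true
∧-elim {true} {true} _ = refl , refl

∧-false : ∀ x {y} → x ∧ y ≡ false → x ≡ false ⊎ y ≡ false
∧-false false _ = inj₁ refl
∧-false true  p = inj₂ p

∨-introˡ : ∀ {x y} → x ≡ true → x ∨ y ≡ true
∨-introˡ refl = refl

∨-introʳ : ∀ {x y} → y ≡ true → x ∨ y ≡ true
∨-introʳ {true}  _ = refl
∨-introʳ {false} p = p

∨-intro-false⇒ : ∀ x {y} → (x ≡ false → y ≡ true) → x ∨ y ≡ true
∨-intro-false⇒ true  _ = refl
∨-intro-false⇒ false y = y refl

∨-elim : ∀ {x y} → x ∨ y ≡ true → x ≡ true ⊎ y ≡ true
∨-elim {true}  _ = inj₁ refl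
∨-elim {false} p = inj₂ p

∩-⊆ˡ : ∀ (F G : VSet n) → F ∩ G ⊆ F
∩-⊆ˡ F G v p = proj₁ (∧-elim {F v} p)

∩-⊆ʳ : ∀ (F G : VSet n) → F ∩ G ⊆ G
∩-⊆ʳ F G v p = proj₂ (∧-elim {F v} p)

⊎⇒∈∪ : ∀ (F G : VSet n) {v} → v ∈V F ⊎ v ∈V G → v ∈V (F ∪ G)
⊎⇒∈∪ F G {v} = [ ∨-introˡ , ∨-introʳ {F v} ]

¬∈⇒∉ : ∀ (F : VSet n) {v} → ¬ v ∈V F → v ∉V F
¬∈⇒∉ F {v} v∉F with F v
... | false = refl
... | true  = ⊥-elim (v∉F refl)

⊆-∉ : F ⊆ G → ∀ {v} → v ∉V G → v ∉V F
⊆-∉ {F = F} F⊆G v∉G = ¬∈⇒∉ F (λ v∈F → true≢false (F⊆G _ v∈F) v∉G)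

⊆-antisym : F ⊆ G → G ⊆ F → ∀ v → F v ≡ G v
⊆-antisym {F = F} F⊆G G⊆F v with F v in Fv
... | true  = sym (F⊆G v Fv)
... | false = sym (⊆-∉ G⊆F Fv)

∈∁-∉ : ∀ (F : VSet n) {v} → v ∈V ∁ F → v ∉V F
∈∁-∉ F = Bool.not-injective {y = false}

∉∁-∈ : ∀ (F : VSet n) {v} → v ∉V ∁ F → v ∈V F
∉∁-∈ F = Bool.not-injective {y = true}

m+n≤o+p⇒p≤n⇒m≤o : ∀ {m n o p} → m + n ≤ o + p → p ≤ n → m ≤ o
m+n≤o+p⇒p≤n⇒m≤o {m} {n} {o} {p} m+n≤o+p p≤n =
  +-cancelʳ-≤ p m o (≤-trans (+-monoʳ-≤ m p≤n) m+n≤o+p)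

private
  𝟙 : Bool → ℕ
  𝟙 x = if x then 1 else 0

  𝟙-mono : ∀ {x y} → (x ≡ true → y ≡ true) → 𝟙 x ≤ 𝟙 y
  𝟙-mono {false} _   = z≤n
  𝟙-mono {true}  x⇒y rewrite x⇒y refl = ≤-refl

  1≤𝟙+𝟙 : ∀ {z w} → z ≡ true ⊎ w ≡ true → 1 ≤ 𝟙 z + 𝟙 w
  1≤𝟙+𝟙     (inj₁ refl) = s≤s z≤n
  1≤𝟙+𝟙 {z} (inj₂ refl) = m≤n+m 1 (𝟙 z)

  𝟙-mono₂ : ∀ {x y z w} → (x ≡ true → y ≡ true → z ≡ true × w ≡ true) →
            (x ≡ true ⊎ y ≡ true → z ≡ true ⊎ w ≡ true) → 𝟙 x + 𝟙 y ≤ 𝟙 z + 𝟙 w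
  𝟙-mono₂ {false} {false} _    _   = z≤n
  𝟙-mono₂ {true}  {true}  both _   rewrite proj₁ (both refl refl) | proj₂ (both refl refl) = ≤-refl
  𝟙-mono₂ {true}  {false} _    one = 1≤𝟙+𝟙 (one (inj₁ refl))
  𝟙-mono₂ {false} {true}  _    one = 1≤𝟙+𝟙 (one (inj₂ refl))

countFin-mono : ∀ {f g : Fin n → Bool} → (∀ i → f i ≡ true → g i ≡ true) → countFin f ≤ countFin g
countFin-mono {zero}  _   = z≤n
countFin-mono {suc n} f⊆g = +-mono-≤ (𝟙-mono (f⊆g zero)) (countFin-mono (λ i → f⊆g (suc i)))

countFin-mono-< : ∀ {f g : Fin n → Bool} → (∀ i → f i ≡ true → g i ≡ true) →
                  ∀ i → g i ≡ true → f i ≡ false → countFin f < countFin g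
countFin-mono-< f⊆g zero    gi fi rewrite gi | fi = s≤s (countFin-mono (λ i → f⊆g (suc i)))
countFin-mono-< f⊆g (suc i) gi fi =
  +-mono-≤-< (𝟙-mono (f⊆g zero)) (countFin-mono-< (λ i → f⊆g (suc i)) i gi fi)

countFin-mono₂ : ∀ {f g h k : Fin n → Bool} →
                 (∀ i → f i ≡ true → g i ≡ true → h i ≡ true × k i ≡ true) →
                 (∀ i → f i ≡ true ⊎ g i ≡ true → h i ≡ true ⊎ k i ≡ true) →
                 countFin f + countFin g ≤ countFin h + countFin k
countFin-mono₂ {zero}                  _    _   = z≤n
countFin-mono₂ {suc n} {f} {g} {h} {k} both one = begin
  countFin f + countFin g
    ≡⟨ interchange (𝟙 (f zero)) (countFin (tail f)) (𝟙 (g zero)) (countFin (tail g)) ⟩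
  (𝟙 (f zero) + 𝟙 (g zero)) + (countFin (tail f) + countFin (tail g))
    ≤⟨ +-mono-≤ (𝟙-mono₂ (both zero) (one zero)) (countFin-mono₂ (λ i → both (suc i)) (λ i → one (suc i))) ⟩
  (𝟙 (h zero) + 𝟙 (k zero)) + (countFin (tail h) + countFin (tail k))
    ≡⟨ interchange (𝟙 (h zero)) (𝟙 (k zero)) (countFin (tail h)) (countFin (tail k)) ⟩
  countFin h + countFin k
    ∎
  where open ≤-Reasoning

countFin-permute : ∀ (f : Fin n → Bool) (π : Permutation n n) → countFin (λ i → f (π ⟨$⟩ʳ i)) ≡ countFin f
countFin-permute f π = begin
  countFin (λ i → f (π ⟨$⟩ʳ i)) ≡⟨ countFin≡sum (λ i → f (π ⟨$⟩ʳ i)) ⟩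
  sum (λ i → 𝟙 (f (π ⟨$⟩ʳ i)))  ≡⟨ sum-permute (λ i → 𝟙 (f i)) π ⟨
  sum (λ i → 𝟙 (f i))            ≡⟨ countFin≡sum f ⟨
  countFin f                     ∎
  where
  open ≡-Reasoning
  countFin≡sum : ∀ {n} (f : Fin n → Bool) → countFin f ≡ sum (λ i → 𝟙 (f i))
  countFin≡sum {zero}  f = refl
  countFin≡sum {suc n} f = cong (𝟙 (f zero) +_) (countFin≡sum (tail f))

∣∣-mono : F ⊆ G → ∣ F ∣V ≤ ∣ G ∣V
∣∣-mono F⊆G = +-mono-≤ (countFin-mono (λ g → F⊆G (g , false))) (countFin-mono (λ g → F⊆G (g , true)))

∣∣-mono-< : F ⊆ G → ∀ {v} → v ∈V G → v ∉V F → ∣ F ∣V < ∣ G ∣V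
∣∣-mono-< F⊆G {g , false} v∈G v∉F =
  +-mono-<-≤ (countFin-mono-< (λ g → F⊆G (g , false)) g v∈G v∉F) (countFin-mono (λ g → F⊆G (g , true)))
∣∣-mono-< F⊆G {g , true}  v∈G v∉F =
  +-mono-≤-< (countFin-mono (λ g → F⊆G (g , false))) (countFin-mono-< (λ g → F⊆G (g , true)) g v∈G v∉F)

∣∣-cong : (∀ v → F v ≡ G v) → ∣ F ∣V ≡ ∣ G ∣V
∣∣-cong F≗G = ≤-antisym (∣∣-mono (λ v p → trans (sym (F≗G v)) p)) (∣∣-mono (λ v p → trans (F≗G v) p))

⊆∧∣∣≥⇒⊇ : F ⊆ G → ∣ G ∣V ≤ ∣ F ∣V → G ⊆ F
⊆∧∣∣≥⇒⊇ {F = F} F⊆G ∣G∣≤∣F∣ v v∈G with F v in Fv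
... | true  = refl
... | false = ⊥-elim (<⇒≱ (∣∣-mono-< F⊆G v∈G Fv) ∣G∣≤∣F∣)

∣∣-mono₂ : (∀ v → v ∈V F → v ∈V G → v ∈V H × v ∈V K) →
           (∀ v → v ∈V F ⊎ v ∈V G → v ∈V H ⊎ v ∈V K) →
           ∣ F ∣V + ∣ G ∣V ≤ ∣ H ∣V + ∣ K ∣V
∣∣-mono₂ {F = F} {G = G} {H = H} {K = K} both one = begin
  ∣ F ∣V + ∣ G ∣V
    ≡⟨ interchange (#₀ F) (#₁ F) (#₀ G) (#₁ G) ⟩
  (#₀ F + #₀ G) + (#₁ F + #₁ G)
    ≤⟨ +-mono-≤ (countFin-mono₂ (λ g → both (g , false)) (λ g → one (g , false)))
                (countFin-mono₂ (λ g → both (g , true)) (λ g → one (g , true))) ⟩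
  (#₀ H + #₀ K) + (#₁ H + #₁ K)
    ≡⟨ interchange (#₀ H) (#₀ K) (#₁ H) (#₁ K) ⟩
  ∣ H ∣V + ∣ K ∣V
    ∎
  where
  open ≤-Reasoning
  #₀ #₁ : VSet _ → ℕ
  #₀ F = countFin (part F false)
  #₁ F = countFin (part F true)

∣∣-permute : ∀ (F : VSet n) (π : Permutation n n) → ∣ (λ v → F (π ⟨$⟩ʳ proj₁ v , proj₂ v)) ∣V ≡ ∣ F ∣V
∣∣-permute F π = cong₂ _+_ (countFin-permute (part F false) π) (countFin-permute (part F true) π)

anyFin-intro : ∀ (f : Fin n → Bool) i → f i ≡ true → anyFin f ≡ true
anyFin-intro f zero    fi = ∨-introˡ fi
anyFin-intro f (suc i) fi = ∨-introʳ {f zero} (anyFin-intro (tail f) i fi)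

anyFin-elim : ∀ (f : Fin n → Bool) → anyFin f ≡ true → ∃ λ i → f i ≡ true
anyFin-elim {suc n} f any with ∨-elim {f zero} any
... | inj₁ f0 = zero , f0
... | inj₂ fs = let i , fi = anyFin-elim (tail f) fs in suc i , fi

anyFin-false : ∀ (f : Fin n → Bool) → anyFin f ≡ false → ∀ i → f i ≡ false
anyFin-false f none i with f i in fi
... | false = refl
... | true  = ⊥-elim (true≢false (anyFin-intro f i fi) none)

anyV-intro : ∀ (F : VSet n) v → v ∈V F → anyV F ≡ true
anyV-intro F (g , false) v∈F = ∨-introˡ (anyFin-intro (part F false) g v∈F)
anyV-intro F (g , true)  v∈F = ∨-introʳ {anyFin (part F false)} (anyFin-intro (part F true) g v∈F)

anyV-elim : ∀ (F : VSet n) → anyV F ≡ true → ∃ λ v → v ∈V F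
anyV-elim F any with ∨-elim {anyFin (part F false)} any
... | inj₁ any₀ = let g , p = anyFin-elim (part F false) any₀ in (g , false) , p
... | inj₂ any₁ = let g , p = anyFin-elim (part F true)  any₁ in (g , true)  , p

anyV-false : ∀ (F : VSet n) → anyV F ≡ false → ∀ v → v ∉V F
anyV-false F none v = ¬∈⇒∉ F (λ v∈F → true≢false (anyV-intro F v v∈F) none)

-- N⁻ D and C⁻ D are definitionally N⁺ (converse D) and C⁺ (converse D), so every statement
-- about positive fragments yields its negative counterpart by passing to the converse.
converse : Digraph n → Digraph n
converse D u v = D v u

Reach-snoc : ∀ {u v w} → Reach D S u v → D v w ≡ true → w ∈V S → Reach D S u w
Reach-snoc (here u∈S)       Dvw w∈S = step u∈S Dvw (here w∈S)
Reach-snoc (step u∈S Duv r) Dvw w∈S = step u∈S Duv (Reach-snoc r Dvw w∈S)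

Reach-reverse : ∀ {u v} → Reach D S u v → Reach (converse D) S v u
Reach-reverse (here u∈S)       = here u∈S
Reach-reverse (step u∈S Duv r) = Reach-snoc (Reach-reverse r) Duv u∈S

StronglyConnectedOn-converse : StronglyConnectedOn D S → StronglyConnectedOn (converse D) S
StronglyConnectedOn-converse sc u v u∈S v∈S = Reach-reverse (sc v u v∈S u∈S)

IsCut-converse : IsCut D S → IsCut (converse D) S
IsCut-converse (inj₁ trivial)            = inj₁ trivial
IsCut-converse (inj₂ ¬stronglyConnected) = inj₂ (λ sc → ¬stronglyConnected (StronglyConnectedOn-converse sc))

Bipartite : Digraph n → Set
Bipartite D = ∀ g k i → D (g , i) (k , i) ≡ false

Bipartite-converse : Bipartite D → Bipartite (converse D)
Bipartite-converse bipartite g k i = bipartite k g i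

Aut-converse : ∀ {A} → Aut (converse D) A → Aut D A
Aut-converse σ = record { perm = Aut.perm σ ; preserve = λ u v → Aut.preserve σ v u }

TransitiveOnPart-converse : ∀ {A i} → TransitiveOnPart (converse D) A i → TransitiveOnPart D A i
TransitiveOnPart-converse transitive u v u∈Xᵢ v∈Xᵢ =
  let σ , σu≡v = transitive u v u∈Xᵢ v∈Xᵢ in Aut-converse σ , σu≡v

module _ {κ : ℕ} where

  IsConnectivity-converse : IsConnectivity D κ → IsConnectivity (converse D) κ
  IsConnectivity-converse ((S , cut , ∣S∣) , minimum) =
    (S , IsCut-converse cut , ∣S∣) , λ S cut → minimum S (IsCut-converse cut)

  Atom-converse : ∀ {A} → Atom D κ A → Atom (converse D) κ A
  Atom-converse (fragment , minimum) = swap fragment , λ F fragment′ → minimum F (swap fragment′)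

  DisjointUnionOf-map : ∀ {Q Q′ : VSet n → Set} → (∀ {F} → Q F → Q′ F) →
                        DisjointUnionOf D κ Q → DisjointUnionOf D κ Q′
  DisjointUnionOf-map Q⇒Q′ (m , P , Q-blocks , unique-block) = m , P , (λ j → Q⇒Q′ (Q-blocks j)) , unique-block

module _ (D : Digraph n) where

  N⁺-intro : ∀ F {u v} → v ∉V F → u ∈V F → D u v ≡ true → v ∈V N⁺ D F
  N⁺-intro F {u} {v} v∉F u∈F Duv =
    ∧-intro (cong not v∉F) (anyV-intro (λ w → F w ∧ D w v) u (∧-intro u∈F Duv))

  N⁺-elim : ∀ F {v} → v ∈V N⁺ D F → v ∉V F × ∃ λ u → u ∈V F × D u v ≡ true
  N⁺-elim F {v} v∈N⁺F with ∧-elim {not (F v)} v∈N⁺F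
  ... | v∈∁F , arc with anyV-elim (λ w → F w ∧ D w v) arc
  ...   | u , p = ∈∁-∉ F v∈∁F , u , ∧-elim {F u} p

  ∈-∉N⁺ : ∀ F {v} → v ∈V F → v ∉V N⁺ D F
  ∈-∉N⁺ F v∈F rewrite v∈F = refl

  ∉C⁺ : ∀ F {v} → v ∉V C⁺ D F → v ∉V F × v ∉V N⁺ D F
  ∉C⁺ F {v} v∉C⁺F = Bool.∨-conicalˡ (F v) _ v∉C⁺F , Bool.∨-conicalʳ (F v) _ v∉C⁺F

  C⁺-N⁺ : ∀ F {v} → v ∈V C⁺ D F → v ∉V F → v ∈V N⁺ D F
  C⁺-N⁺ F v∈C⁺F v∉F rewrite v∉F = v∈C⁺F

  C⁺-∉N⁺ : ∀ F {v} → v ∈V C⁺ D F → v ∉V N⁺ D F → v ∈V F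
  C⁺-∉N⁺ F {v} v∈C⁺F v∉N⁺F with ∨-elim {F v} v∈C⁺F
  ... | inj₁ v∈F   = v∈F
  ... | inj₂ v∈N⁺F = ⊥-elim (true≢false v∈N⁺F v∉N⁺F)

  C⁺-arc : ∀ F {u v} → u ∈V F → D u v ≡ true → v ∈V C⁺ D F
  C⁺-arc F {v = v} u∈F Duv = ∨-intro-false⇒ (F v) (λ v∉F → N⁺-intro F v∉F u∈F Duv)

  N⁺⊆C⁺ : F ⊆ G → N⁺ D F ⊆ C⁺ D G
  N⁺⊆C⁺ {F = F} {G = G} F⊆G v v∈N⁺F =
    let _ , u , u∈F , Duv = N⁺-elim F v∈N⁺F in C⁺-arc G (F⊆G u u∈F) Duv

  C⁺-mono : F ⊆ G → C⁺ D F ⊆ C⁺ D G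
  C⁺-mono {F = F} F⊆G v v∈C⁺F with ∨-elim {F v} v∈C⁺F
  ... | inj₁ v∈F   = ∨-introˡ (F⊆G v v∈F)
  ... | inj₂ v∈N⁺F = N⁺⊆C⁺ F⊆G v v∈N⁺F

  N⁺-∪ : ∀ F G {v} → v ∈V N⁺ D (F ∪ G) → v ∈V N⁺ D F ⊎ v ∈V N⁺ D G
  N⁺-∪ F G {v} v∈N⁺ with N⁺-elim (F ∪ G) v∈N⁺
  ... | v∉F∪G , u , u∈F∪G , Duv with ∨-elim {F u} u∈F∪G
  ...   | inj₁ u∈F = inj₁ (N⁺-intro F (Bool.∨-conicalˡ (F v) _ v∉F∪G) u∈F Duv)
  ...   | inj₂ u∈G = inj₂ (N⁺-intro G (Bool.∨-conicalʳ (F v) _ v∉F∪G) u∈G Duv)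

  C⁺-∪ : ∀ F G → C⁺ D (F ∪ G) ⊆ C⁺ D F ∪ C⁺ D G
  C⁺-∪ F G v v∈C⁺ = ⊎⇒∈∪ (C⁺ D F) (C⁺ D G) (split (∨-elim {(F ∪ G) v} v∈C⁺))
    where
    split : v ∈V (F ∪ G) ⊎ v ∈V N⁺ D (F ∪ G) → v ∈V C⁺ D F ⊎ v ∈V C⁺ D G
    split (inj₁ v∈F∪G) = Sum.map ∨-introˡ ∨-introˡ (∨-elim {F v} v∈F∪G)
    split (inj₂ v∈N⁺)  = Sum.map (∨-introʳ {F v}) (∨-introʳ {G v}) (N⁺-∪ F G v∈N⁺)

  C⁺-∖-N⁺ : ∀ F G {v} → v ∈V C⁺ D F → v ∉V F ∩ G → v ∈V (F ∖ G) ⊎ v ∈V N⁺ D F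
  C⁺-∖-N⁺ F G {v} v∈C⁺F v∉F∩G with ∨-elim {F v} v∈C⁺F
  ... | inj₁ v∈F   = inj₁ (∧-intro v∈F (cong not (subst (λ b → b ∧ G v ≡ false) v∈F v∉F∩G)))
  ... | inj₂ v∈N⁺F = inj₂ v∈N⁺F

  N⁺-submodular : ∀ F G → ∣ N⁺ D (F ∩ G) ∣V + ∣ N⁺ D (F ∪ G) ∣V ≤ ∣ N⁺ D F ∣V + ∣ N⁺ D G ∣V
  N⁺-submodular F G = ∣∣-mono₂ both either
    where
    both : ∀ v → v ∈V N⁺ D (F ∩ G) → v ∈V N⁺ D (F ∪ G) → v ∈V N⁺ D F × v ∈V N⁺ D G
    both v v∈N⁺∩ v∈N⁺∪ =
      C⁺-N⁺ F (N⁺⊆C⁺ (∩-⊆ˡ F G) v v∈N⁺∩) (Bool.∨-conicalˡ (F v) _ v∉F∪G) ,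
      C⁺-N⁺ G (N⁺⊆C⁺ (∩-⊆ʳ F G) v v∈N⁺∩) (Bool.∨-conicalʳ (F v) _ v∉F∪G)
      where v∉F∪G = proj₁ (N⁺-elim (F ∪ G) v∈N⁺∪)
    either : ∀ v → v ∈V N⁺ D (F ∩ G) ⊎ v ∈V N⁺ D (F ∪ G) → v ∈V N⁺ D F ⊎ v ∈V N⁺ D G
    either v (inj₂ v∈N⁺∪) = N⁺-∪ F G v∈N⁺∪
    either v (inj₁ v∈N⁺∩) with ∧-false (F v) (proj₁ (N⁺-elim (F ∩ G) v∈N⁺∩))
    ... | inj₁ v∉F = inj₁ (C⁺-N⁺ F (N⁺⊆C⁺ (∩-⊆ˡ F G) v v∈N⁺∩) v∉F)
    ... | inj₂ v∉G = inj₂ (C⁺-N⁺ G (N⁺⊆C⁺ (∩-⊆ʳ F G) v v∈N⁺∩) v∉G)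

  outdeg≤∣N⁺∣ : ∀ F {u} → u ∈V F → (∀ v → D u v ≡ true → v ∉V F) → outdeg D u ≤ ∣ N⁺ D F ∣V
  outdeg≤∣N⁺∣ F u∈F leaves = ∣∣-mono (λ v Duv → N⁺-intro F (leaves v Duv) u∈F Duv)

  Reach-source : ∀ {u v} → Reach D S u v → u ∈V S
  Reach-source (here u∈S)     = u∈S
  Reach-source (step u∈S _ _) = u∈S

  Reach-avoiding-N⁺ : ∀ F {u v} → Reach D (∁ (N⁺ D F)) u v → u ∈V F → v ∈V F
  Reach-avoiding-N⁺ F (here _)       u∈F = u∈F
  Reach-avoiding-N⁺ F (step _ Duw r) u∈F =
    Reach-avoiding-N⁺ F r (C⁺-∉N⁺ F (C⁺-arc F u∈F Duw) (∈∁-∉ (N⁺ D F) (Reach-source r)))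

  κ≤∣N⁺∣ : ∀ {κ} F → IsConnectivity D κ → Nonempty D F → NotAll D (C⁺ D F) → κ ≤ ∣ N⁺ D F ∣V
  κ≤∣N⁺∣ F (_ , minimum) (u , u∈F) (w , w∉C⁺F) = minimum (N⁺ D F) (inj₂ separated)
    where
    separated : ¬ StronglyConnectedOn D (∁ (N⁺ D F))
    separated sc =
      let w∉F , w∉N⁺F = ∉C⁺ F w∉C⁺F in
      true≢false (Reach-avoiding-N⁺ F (sc u w (cong not (∈-∉N⁺ F u∈F)) (cong not w∉N⁺F)) u∈F) w∉F

N⁻∁C⁺⊆N⁺ : ∀ (D : Digraph n) F → N⁻ D (∁ (C⁺ D F)) ⊆ N⁺ D F
N⁻∁C⁺⊆N⁺ D F v v∈N⁻ =
  let v∉∁C⁺F , u , u∈∁C⁺F , Dvu = N⁺-elim (converse D) (∁ (C⁺ D F)) v∈N⁻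
      v∉F = ¬∈⇒∉ F (λ v∈F → true≢false (C⁺-arc D F v∈F Dvu) (∈∁-∉ (C⁺ D F) u∈∁C⁺F))
  in C⁺-N⁺ D F (∉∁-∈ (C⁺ D F) v∉∁C⁺F) v∉F

module _ {D : Digraph n} {κ : ℕ} (conn : IsConnectivity D κ) where

  ∁C⁺-negFragment : PosFragment D κ F → NegFragment D κ (∁ (C⁺ D F))
  ∁C⁺-negFragment {F = F} ((x , x∈F) , ∣N⁺F∣ , (w , w∉C⁺F)) =
    (w , cong not w∉C⁺F) , ≤-antisym ∣N⁻∣≤κ κ≤∣N⁻∣ , (x , x∉C⁻)
    where
    x∉C⁻ : x ∉V C⁻ D (∁ (C⁺ D F))
    x∉C⁻ = cong₂ _∨_ (cong not (∨-introˡ x∈F)) (⊆-∉ (N⁻∁C⁺⊆N⁺ D F) (∈-∉N⁺ D F x∈F))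
    ∣N⁻∣≤κ = ≤-trans (∣∣-mono (N⁻∁C⁺⊆N⁺ D F)) (≤-reflexive ∣N⁺F∣)
    κ≤∣N⁻∣ = κ≤∣N⁺∣ (converse D) (∁ (C⁺ D F)) (IsConnectivity-converse conn)
                    (w , cong not w∉C⁺F) (x , x∉C⁻)

  κ≤∣N⁺∩∣ : ∀ G {x} → PosFragment D κ F → x ∈V (F ∩ G) → κ ≤ ∣ N⁺ D (F ∩ G) ∣V
  κ≤∣N⁺∩∣ {F = F} G {x} (_ , _ , (w , w∉C⁺F)) x∈F∩G =
    κ≤∣N⁺∣ D (F ∩ G) conn (x , x∈F∩G) (w , ⊆-∉ (C⁺-mono D (∩-⊆ˡ F G)) w∉C⁺F)

  ∩-posFragment : ∀ {x w} → PosFragment D κ F → PosFragment D κ G →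
                  x ∈V (F ∩ G) → w ∉V C⁺ D F ∪ C⁺ D G → PosFragment D κ (F ∩ G)
  ∩-posFragment {F = F} {G = G} {x} {w} fragF@(_ , ∣N⁺F∣ , (w₀ , w₀∉C⁺F)) (_ , ∣N⁺G∣ , _)
                x∈F∩G w∉C⁺F∪C⁺G =
    (x , x∈F∩G) , ≤-antisym ∣N⁺∩∣≤κ (κ≤∣N⁺∩∣ G fragF x∈F∩G) ,
    (w₀ , ⊆-∉ (C⁺-mono D (∩-⊆ˡ F G)) w₀∉C⁺F)
    where
    κ≤∣N⁺∪∣ = κ≤∣N⁺∣ D (F ∪ G) conn (x , ∨-introˡ (∩-⊆ˡ F G x x∈F∩G))
                                    (w , ⊆-∉ (C⁺-∪ D F G) w∉C⁺F∪C⁺G)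
    ∣N⁺∩∣≤κ = m+n≤o+p⇒p≤n⇒m≤o (≤-trans (N⁺-submodular D F G) (≤-reflexive (cong₂ _+_ ∣N⁺F∣ ∣N⁺G∣)))
                               κ≤∣N⁺∪∣

  -- Pointwise, ∣ ∁ (C⁺ G) ∣ + ∣ N⁺ (F ∩ G) ∣ ≤ ∣ F ∖ G ∣ + ∣ N⁺ F ∣, and ∣ N⁺ F ∣ = κ ≤ ∣ N⁺ (F ∩ G) ∣.
  ∁C⁺-smaller : ∀ {x} → PosFragment D κ F → x ∈V (F ∩ G) → (∀ v → v ∈V (C⁺ D F ∪ C⁺ D G)) →
                ∣ ∁ (C⁺ D G) ∣V < ∣ F ∣V
  ∁C⁺-smaller {F = F} {G = G} {x} fragF@(_ , ∣N⁺F∣ , _) x∈F∩G covered = begin-strict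
    ∣ ∁ (C⁺ D G) ∣V
      ≤⟨ m+n≤o+p⇒p≤n⇒m≤o (≤-trans (∣∣-mono₂ both either) (≤-reflexive (cong (∣ F ∖ G ∣V +_) ∣N⁺F∣)))
                          (κ≤∣N⁺∩∣ G fragF x∈F∩G) ⟩
    ∣ F ∖ G ∣V
      <⟨ ∣∣-mono-< (∩-⊆ˡ F (∁ G)) (∩-⊆ˡ F G x x∈F∩G)
                   (⊆-∉ (∩-⊆ʳ F (∁ G)) (cong not (∩-⊆ʳ F G x x∈F∩G))) ⟩
    ∣ F ∣V
      ∎
    where
    open ≤-Reasoning
    both : ∀ v → v ∈V ∁ (C⁺ D G) → v ∈V N⁺ D (F ∩ G) → v ∈V (F ∖ G) × v ∈V N⁺ D F
    both v v∈∁C⁺G v∈N⁺∩ = ⊥-elim (true≢false (N⁺⊆C⁺ D (∩-⊆ʳ F G) v v∈N⁺∩) (∈∁-∉ (C⁺ D G) v∈∁C⁺G))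
    either : ∀ v → v ∈V ∁ (C⁺ D G) ⊎ v ∈V N⁺ D (F ∩ G) → v ∈V (F ∖ G) ⊎ v ∈V N⁺ D F
    either v (inj₂ v∈N⁺∩)  =
      C⁺-∖-N⁺ D F G (N⁺⊆C⁺ D (∩-⊆ˡ F G) v v∈N⁺∩) (proj₁ (N⁺-elim D (F ∩ G) v∈N⁺∩))
    either v (inj₁ v∈∁C⁺G) = C⁺-∖-N⁺ D F G v∈C⁺F (⊆-∉ (∩-⊆ʳ F G) (proj₁ (∉C⁺ D G v∉C⁺G)))
      where
      v∉C⁺G = ∈∁-∉ (C⁺ D G) v∈∁C⁺G
      v∈C⁺F = [ id , (λ v∈C⁺G → ⊥-elim (true≢false v∈C⁺G v∉C⁺G)) ] (∨-elim {C⁺ D F v} (covered v))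

  posAtom-⊆ : ∀ {x} → PosAtom D κ F → PosFragment D κ G → x ∈V F → x ∈V G → F ⊆ G
  posAtom-⊆ {F = F} {G = G} ((_ , minimal) , fragF) fragG x∈F x∈G
    with anyV (∁ (C⁺ D F ∪ C⁺ D G)) in some-outside
  ... | true  = λ v v∈F → ∩-⊆ʳ F G v (F⊆F∩G v v∈F)
    where
    w∉C⁺F∪C⁺G = ∈∁-∉ (C⁺ D F ∪ C⁺ D G) (proj₂ (anyV-elim (∁ (C⁺ D F ∪ C⁺ D G)) some-outside))
    F⊆F∩G = ⊆∧∣∣≥⇒⊇ (∩-⊆ˡ F G)
              (minimal (F ∩ G) (inj₁ (∩-posFragment fragF fragG (∧-intro x∈F x∈G) w∉C⁺F∪C⁺G)))
  ... | false = ⊥-elim (<⇒≱ (∁C⁺-smaller {G = G} fragF (∧-intro x∈F x∈G) covered)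
                            (minimal (∁ (C⁺ D G)) (inj₂ (∁C⁺-negFragment fragG))))
    where
    covered : ∀ v → v ∈V (C⁺ D F ∪ C⁺ D G)
    covered v = ∉∁-∈ (C⁺ D F ∪ C⁺ D G) (anyV-false (∁ (C⁺ D F ∪ C⁺ D G)) some-outside v)

  posAtoms-meet⇒≗ : ∀ {x} → PosAtom D κ F → PosAtom D κ G → x ∈V F → x ∈V G → ∀ v → F v ≡ G v
  posAtoms-meet⇒≗ atomF atomG x∈F x∈G =
    ⊆-antisym (posAtom-⊆ atomF (proj₂ atomG) x∈F x∈G) (posAtom-⊆ atomG (proj₂ atomF) x∈G x∈F)

Unique-lookup-injective : ∀ {c ℓ} (S : Setoid c ℓ) {xs} → Unique S xs →
                          ∀ {i j} → Setoid._≈_ S (lookup xs i) (lookup xs j) → i ≡ j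
Unique-lookup-injective S (_  ∷ _)        {zero}  {zero}  _  = refl
Unique-lookup-injective S (x≉ ∷ _)        {zero}  {suc j} eq = ⊥-elim (All.lookup x≉ (∈-lookup j) eq)
Unique-lookup-injective S (x≉ ∷ _)        {suc i} {zero}  eq = ⊥-elim (All.lookup x≉ (∈-lookup i) (Setoid.sym S eq))
Unique-lookup-injective S (_  ∷ distinct) {suc i} {suc j} eq = cong suc (Unique-lookup-injective S distinct eq)

module _ {m : ℕ} (P : Fin m → VSet n) where

  private
    Same : Fin m → Fin m → Set
    Same h h′ = ∀ v → P h v ≡ P h′ v

    same? : ∀ h h′ → Dec (Same h h′)
    same? h h′ = map′ (λ (same₀ , same₁) → λ { (g , false) → same₀ g ; (g , true) → same₁ g })
                      (λ same → (λ g → same (g , false)) , (λ g → same (g , true)))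
                      (all? (λ g → P h (g , false) Bool.≟ P h′ (g , false)) ×-dec
                       all? (λ g → P h (g , true)  Bool.≟ P h′ (g , true)))

    blocks : DecSetoid 0ℓ 0ℓ
    blocks = record
      { Carrier          = Fin m
      ; _≈_              = Same
      ; isDecEquivalence = record
        { isEquivalence = record
          { refl  = λ _ → refl
          ; sym   = λ same v → sym (same v)
          ; trans = λ same same′ v → trans (same v) (same′ v)
          }
        ; _≟_ = same?
        }
      }

    representatives : List (Fin m)
    representatives = deduplicate same? (allFin m)

  equal-or-disjoint⇒partition : ∀ {D : Digraph n} {κ} {Q : VSet n → Set} → (∀ h → Q (P h)) →
    (∀ v → ∃ λ h → v ∈V P h) → (∀ h h′ {v} → v ∈V P h → v ∈V P h′ → ∀ w → P h w ≡ P h′ w) →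
    DisjointUnionOf D κ Q
  equal-or-disjoint⇒partition Q-blocks covered meet⇒same =
    length representatives , (λ j → P (lookup representatives j)) , (λ j → Q-blocks _) , unique-block
    where
    unique-block : ∀ v → Σ (Fin (length representatives)) λ j →
      (v ∈V P (lookup representatives j)) × (∀ j′ → v ∈V P (lookup representatives j′) → j′ ≡ j)
    unique-block v = Any.index v∈rep , lookup-index v∈rep , λ j′ v∈j′ →
      Unique-lookup-injective (DecSetoid.setoid blocks) (deduplicate-! blocks (allFin m))
                              (meet⇒same _ _ v∈j′ (lookup-index v∈rep))
      where
      v∈rep : Any (λ h → v ∈V P h) representatives
      v∈rep = Any.deduplicate⁺ same? (λ same v∈ → trans (same v) v∈)
                               (lose (∈-allFin (proj₁ (covered v))) (proj₂ (covered v)))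

BD-bipartite : ∀ (G : FinGroup n) T0 T1 → Bipartite (BD G T0 T1)
BD-bipartite G T0 T1 g k false = refl
BD-bipartite G T0 T1 g k true  = refl

module Translations (G : FinGroup n) where
  open FinGroup G

  group : Group 0ℓ 0ℓ
  group = record
    { isGroup = record
      { isMonoid = record
        { isSemigroup = record
          { isMagma = record { isEquivalence = isEquivalence ; ∙-cong = cong₂ _·_ }
          ; assoc   = assoc
          }
        ; identity = idˡ , idʳ
        }
      ; inverse = invˡ , invʳ
      ; ⁻¹-cong = cong inv
      }
    }

  open Algebra.Properties.Group group public
    using (\\-leftDividesˡ; \\-leftDividesʳ; //-rightDividesˡ; //-rightDividesʳ; ε⁻¹≈ε; ⁻¹-anti-homo-∙)

  leftMul rightMul : Fin n → Permutation n n
  leftMul  c = permutation (c ·_) (inv c ·_) (\\-leftDividesˡ c) (\\-leftDividesʳ c)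
  rightMul c = permutation (_· c) (_· inv c) (//-rightDividesˡ c) (//-rightDividesʳ c)

  //-cancel-·ʳ : ∀ h k g → (k · h) · inv (g · h) ≡ k · inv g
  //-cancel-·ʳ h k g = begin
    (k · h) · inv (g · h)     ≡⟨ cong ((k · h) ·_) (⁻¹-anti-homo-∙ g h) ⟩
    (k · h) · (inv h · inv g) ≡⟨ assoc k h _ ⟩
    k · (h · (inv h · inv g)) ≡⟨ cong (k ·_) (\\-leftDividesˡ h (inv g)) ⟩
    k · inv g                 ∎
    where open ≡-Reasoning

  infixl 7 _⋆_

  _⋆_ : V n → Fin n → V n
  v ⋆ h = proj₁ v · h , proj₂ v

  ⋆-⋆⁻¹ : ∀ v h → v ⋆ h ⋆ inv h ≡ v
  ⋆-⋆⁻¹ (g , i) h = cong (_, i) (//-rightDividesʳ h g)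

  ⋆⁻¹-⋆ : ∀ v h → v ⋆ inv h ⋆ h ≡ v
  ⋆⁻¹-⋆ (g , i) h = cong (_, i) (//-rightDividesˡ h g)

  translate : Fin n → VSet n → VSet n
  translate h F v = F (v ⋆ inv h)

  translate-⋆ : ∀ h F v → translate h F (v ⋆ h) ≡ F v
  translate-⋆ h F v = cong F (⋆-⋆⁻¹ v h)

  ∣translate∣ : ∀ h F → ∣ translate h F ∣V ≡ ∣ F ∣V
  ∣translate∣ h F = ∣∣-permute F (rightMul (inv h))

  RightInvariant : Digraph n → Set
  RightInvariant D = ∀ h u v → D (u ⋆ h) (v ⋆ h) ≡ D u v

  RightInvariant-converse : RightInvariant D → RightInvariant (converse D)
  RightInvariant-converse invariant h u v = invariant h v u

  BD-rightInvariant : ∀ T0 T1 → RightInvariant (BD G T0 T1)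
  BD-rightInvariant T0 T1 h (g , false) (k , true)  = cong T0 (//-cancel-·ʳ h k g)
  BD-rightInvariant T0 T1 h (g , true)  (k , false) = cong T1 (//-cancel-·ʳ h g k)
  BD-rightInvariant T0 T1 h (g , false) (k , false) = refl
  BD-rightInvariant T0 T1 h (g , true)  (k , true)  = refl

  module _ (invariant : RightInvariant D) where

    N⁺-translate : ∀ h F v → N⁺ D (translate h F) v ≡ translate h (N⁺ D F) v
    N⁺-translate h F = ⊆-antisym forth back
      where
      forth : N⁺ D (translate h F) ⊆ translate h (N⁺ D F)
      forth v v∈ =
        let v∉ , u , u∈ , Duv = N⁺-elim D (translate h F) v∈ in
        N⁺-intro D F v∉ u∈ (trans (invariant (inv h) u v) Duv)
      back : translate h (N⁺ D F) ⊆ N⁺ D (translate h F)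
      back v v∈ =
        let v∉ , u , u∈F , Du-vh⁻¹ = N⁺-elim D F v∈ in
        N⁺-intro D (translate h F) v∉ (trans (translate-⋆ h F u) u∈F)
          (trans (cong (D (u ⋆ h)) (sym (⋆⁻¹-⋆ v h))) (trans (invariant h u (v ⋆ inv h)) Du-vh⁻¹))

    C⁺-translate : ∀ h F v → C⁺ D (translate h F) v ≡ translate h (C⁺ D F) v
    C⁺-translate h F v = cong (translate h F v ∨_) (N⁺-translate h F v)

    module _ {κ : ℕ} where

      translate-posFragment : ∀ h → PosFragment D κ F → PosFragment D κ (translate h F)
      translate-posFragment {F = F} h ((u , u∈F) , ∣N⁺F∣ , (w , w∉C⁺F)) =
        (u ⋆ h , trans (translate-⋆ h F u) u∈F) ,
        trans (∣∣-cong (N⁺-translate h F)) (trans (∣translate∣ h (N⁺ D F)) ∣N⁺F∣) ,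
        (w ⋆ h , trans (C⁺-translate h F (w ⋆ h)) (trans (translate-⋆ h (C⁺ D F) w) w∉C⁺F))

      translate-posAtom : ∀ h → PosAtom D κ F → PosAtom D κ (translate h F)
      translate-posAtom {F = F} h ((_ , minimal) , fragF) =
        (inj₁ fragFh , λ F′ fragF′ → ≤-trans (≤-reflexive (∣translate∣ h F)) (minimal F′ fragF′)) , fragFh
        where fragFh = translate-posFragment h fragF

Elt-≡ : ∀ {A : VSet n} {u v} {u∈A : u ∈V A} {v∈A : v ∈V A} → u ≡ v →
        _≡_ {A = Σ (V n) λ w → w ∈V A} (u , u∈A) (v , v∈A)
Elt-≡ refl = cong (_ ,_) (Decidable⇒UIP.≡-irrelevant Bool._≟_ _ _)

module PosAtomStructure (G : FinGroup n) {D : Digraph n} (invariant : Translations.RightInvariant G D)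
                        {κ : ℕ} (conn : IsConnectivity D κ) {A : VSet n} (atom : PosAtom D κ A) where
  open FinGroup G
  open Translations G

  translate-fixes : ∀ {u s} → u ∈V A → (u ⋆ s) ∈V A → ∀ v → A v ≡ translate s A v
  translate-fixes {u} {s} u∈A u⋆s∈A =
    posAtoms-meet⇒≗ conn atom (translate-posAtom invariant s atom) u⋆s∈A (trans (translate-⋆ s A u) u∈A)

  ·-closed : ∀ {a b y i j} → (a , i) ∈V A → (b , j) ∈V A → (y , j) ∈V A → ((a · inv b) · y , i) ∈V A
  ·-closed {a} {b} {y} {i} {j} a∈A b∈A y∈A = begin
    A ((a · inv b) · y , i)     ≡⟨ cong (λ g → A (g , i)) (assoc a (inv b) y) ⟩
    A ((a , i) ⋆ s)             ≡⟨ translate-fixes {u = b , j} b∈A b⋆s∈A ((a , i) ⋆ s) ⟩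
    translate s A ((a , i) ⋆ s) ≡⟨ translate-⋆ s A (a , i) ⟩
    A (a , i)                   ≡⟨ a∈A ⟩
    true                        ∎
    where
    open ≡-Reasoning
    s = inv b · y
    b⋆s∈A : ((b , j) ⋆ s) ∈V A
    b⋆s∈A = subst (λ g → A (g , j) ≡ true) (sym (\\-leftDividesˡ b y)) y∈A

  translation-Aut : ∀ s → (∀ v → A v ≡ translate s A v) → Aut D A
  translation-Aut s fixes = record
    { perm     = mk↔ₛ′ forth back (λ (w , _) → Elt-≡ (⋆⁻¹-⋆ w s)) (λ (w , _) → Elt-≡ (⋆-⋆⁻¹ w s))
    ; preserve = λ u v → sym (invariant s (proj₁ u) (proj₁ v))
    }
    where
    forth back : Elt D A → Elt D A
    forth (w , w∈A) = w ⋆ s , trans (fixes (w ⋆ s)) (trans (translate-⋆ s A w) w∈A)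
    back  (w , w∈A) = w ⋆ inv s , trans (sym (fixes w)) w∈A

  transitive : ∀ i → TransitiveOnPart D A i
  transitive i ((a , _) , a∈A) ((b , _) , b∈A) refl refl =
    translation-Aut s (translate-fixes a∈A a⋆s∈A) , Elt-≡ (cong (_, i) (\\-leftDividesˡ a b))
    where
    s = inv a · b
    a⋆s∈A : ((a , i) ⋆ s) ∈V A
    a⋆s∈A = subst (λ g → A (g , i) ≡ true) (sym (\\-leftDividesˡ a b)) b∈A

  subgroup : ∀ i → (e , i) ∈V A → IsSubgroup G (part A i)
  subgroup i e∈A = e∈A , closed , inverse
    where
    closed : ∀ x y → A (x , i) ≡ true → A (y , i) ≡ true → A (x · y , i) ≡ true
    closed x y x∈A y∈A =
      subst (λ g → A (g · y , i) ≡ true) (trans (cong (x ·_) ε⁻¹≈ε) (idʳ x)) (·-closed x∈A e∈A y∈A)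
    inverse : ∀ x → A (x , i) ≡ true → A (inv x , i) ≡ true
    inverse x x∈A = subst (λ g → A (g , i) ≡ true) (trans (idʳ _) (idˡ _)) (·-closed e∈A x∈A e∈A)

  ∣part∣≤∣part∣ : ∀ {a b i j} → (a , i) ∈V A → (b , j) ∈V A → countFin (part A j) ≤ countFin (part A i)
  ∣part∣≤∣part∣ {a} {b} {i} {j} a∈A b∈A = begin
    countFin (part A j)                                    ≤⟨ countFin-mono (λ y → ·-closed {y = y} a∈A b∈A) ⟩
    countFin (λ y → part A i (leftMul (a · inv b) ⟨$⟩ʳ y)) ≡⟨ countFin-permute (part A i) (leftMul (a · inv b)) ⟩
    countFin (part A i)                                    ∎
    where open ≤-Reasoning

  module _ (bipartite : Bipartite D) {δ} (δ≤outdeg : ∀ v → δ ≤ outdeg D v) (κ<δ : κ < δ) where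

    meets-opposite-side : ∀ {g j} → (g , j) ∈V A → ∃ λ k → (k , not j) ∈V A
    meets-opposite-side {g} {j} g∈A with anyFin (part A (not j)) in found
    ... | true  = anyFin-elim (part A (not j)) found
    ... | false = ⊥-elim (<⇒≱ κ<δ (begin
        δ                ≤⟨ δ≤outdeg (g , j) ⟩
        outdeg D (g , j) ≤⟨ outdeg≤∣N⁺∣ D A g∈A leaves ⟩
        ∣ N⁺ D A ∣V      ≡⟨ proj₁ (proj₂ (proj₂ atom)) ⟩
        κ                ∎))
      where
      open ≤-Reasoning
      leaves : ∀ v → D (g , j) v ≡ true → v ∉V A
      leaves (k , j′) Dgk with j′ Bool.≟ j
      ... | yes refl = ⊥-elim (true≢false Dgk (bipartite g k j))
      ... | no j′≢j  = subst (λ i → A (k , i) ≡ false) (sym (Bool.¬-not j′≢j))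
                             (anyFin-false (part A (not j)) found k)

    meets-side : ∀ i → ∃ λ g → (g , i) ∈V A
    meets-side i with proj₁ (proj₂ atom)
    ... | (g , j) , g∈A with j Bool.≟ i
    ...   | yes refl = g , g∈A
    ...   | no j≢i   = let k , k∈A = meets-opposite-side g∈A in
                       k , subst (λ i′ → A (k , i′) ≡ true) (sym (Bool.¬-not (≢-sym j≢i))) k∈A

    ∣A₀∣≡∣A₁∣ : countFin (part A false) ≡ countFin (part A true)
    ∣A₀∣≡∣A₁∣ = ≤-antisym (∣part∣≤∣part∣ (proj₂ (meets-side true))  (proj₂ (meets-side false)))
                          (∣part∣≤∣part∣ (proj₂ (meets-side false)) (proj₂ (meets-side true)))

    translates-partition : DisjointUnionOf D κ (PosAtom D κ)
    translates-partition =
      equal-or-disjoint⇒partition (λ h → translate h A) {D = D} {κ} {PosAtom D κ}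
        (λ h → translate-posAtom invariant h atom) covered
        (λ h h′ → posAtoms-meet⇒≗ conn (translate-posAtom invariant h atom) (translate-posAtom invariant h′ atom))
      where
      covered : ∀ v → ∃ λ h → v ∈V translate h A
      covered (g , i) =
        let a , a∈A = meets-side i in
        inv a · g , subst (λ w → translate (inv a · g) A w ≡ true) (cong (_, i) (\\-leftDividesˡ a g))
                          (trans (translate-⋆ (inv a · g) A (a , i)) a∈A)

module AtomStructure (G : FinGroup n) {D : Digraph n} (invariant : Translations.RightInvariant G D)
                     (bipartite : Bipartite D) {κ δ : ℕ} (conn : IsConnectivity D κ)
                     (minDegree : IsMinDegree D δ) (κ<δ : κ < δ) {A : VSet n} (atom : Atom D κ A) where

  private
    module Pos (pos : PosFragment D κ A) = PosAtomStructure G invariant conn (atom , pos)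
    module Neg (neg : NegFragment D κ A) =
      PosAtomStructure G {D = converse D} (Translations.RightInvariant-converse G {D = D} invariant)
                       (IsConnectivity-converse {D = D} conn) (Atom-converse {D = D} atom , neg)

    δ≤outdeg : ∀ v → δ ≤ outdeg D v
    δ≤outdeg v = proj₁ (proj₁ minDegree v)

    δ≤indeg : ∀ v → δ ≤ outdeg (converse D) v
    δ≤indeg v = proj₂ (proj₁ minDegree v)

  posPartition : PosFragment D κ A → DisjointUnionOf D κ (PosAtom D κ)
  posPartition pos = Pos.translates-partition pos bipartite δ≤outdeg κ<δ

  negPartition : NegFragment D κ A → DisjointUnionOf D κ (NegAtom D κ)
  negPartition neg =
    DisjointUnionOf-map {κ = κ} {D = D} {PosAtom (converse D) κ} {NegAtom D κ}
      (λ (atom′ , neg′) → Atom-converse {D = converse D} atom′ , neg′)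
      (Neg.translates-partition neg (Bipartite-converse {D = D} bipartite) δ≤indeg κ<δ)

  transitive : ∀ i → TransitiveOnPart D A i
  transitive i =
    [ (λ pos → Pos.transitive pos i) , (λ neg → TransitiveOnPart-converse (Neg.transitive neg i)) ] (proj₁ atom)

  subgroup : ∀ i → (FinGroup.e G , i) ∈V A → IsSubgroup G (part A i)
  subgroup = [ Pos.subgroup , Neg.subgroup ] (proj₁ atom)

  ∣A₀∣≡∣A₁∣ : countFin (part A false) ≡ countFin (part A true)
  ∣A₀∣≡∣A₁∣ = [ (λ pos → Pos.∣A₀∣≡∣A₁∣ pos bipartite δ≤outdeg κ<δ)
              , (λ neg → Neg.∣A₀∣≡∣A₁∣ neg (Bipartite-converse {D = D} bipartite) δ≤indeg κ<δ)
              ] (proj₁ atom)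

lemma2p4 : ∀ {n} (G : FinGroup n) (T0 T1 : SubsetG n) (κ δ : ℕ) →
    StronglyConnected (BD G T0 T1) →
    IsConnectivity (BD G T0 T1) κ →
    IsMinDegree (BD G T0 T1) δ →
    κ < δ →
    (A : VSet n) → Atom (BD G T0 T1) κ A →
    ((PosFragment (BD G T0 T1) κ A → DisjointUnionOf (BD G T0 T1) κ (PosAtom (BD G T0 T1) κ))
      × (NegFragment (BD G T0 T1) κ A → DisjointUnionOf (BD G T0 T1) κ (NegAtom (BD G T0 T1) κ)))
    × (TransitiveOnPart (BD G T0 T1) A false × TransitiveOnPart (BD G T0 T1) A true)
    × (∀ (i : Bool) → (FinGroup.e G , i) ∈V A → IsSubgroup G (part A i))
    × (countFin (part A false) ≡ countFin (part A true))
lemma2p4 G T0 T1 κ δ _ conn minDegree κ<δ A atom =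
  (posPartition , negPartition) , (transitive false , transitive true) , subgroup , ∣A₀∣≡∣A₁∣
  where
  open AtomStructure G (Translations.BD-rightInvariant G T0 T1) (BD-bipartite G T0 T1) conn minDegree κ<δ atom
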